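{- Let $k$ and $m$ be nonnegative integers. (i) The independence polynomial of $(T_{1,3}^v:P_2^w)_{k,k+m}$ is monic and has degree $2k + m + 6$. (ii) The independence polynomial of $S_{2,k}$ is monic and has degree $k + 1$.
   Context: $I(G;x)=\sum_i s_ix^i$ with $s_i$ the number of independent sets of size $i$ in $G$. For a rooted graph $H^w$ and $k\ge0$, $Z_k(H^w)$ is a new vertex $v_0$ joined to the roots of $k$ disjoint copies of $H$; $(G^v:H^w)_k$ is the disjoint union of $G$ and $Z_k(H^w)$ plus the edge $vv_0$, rooted at $v$; $(G^v:H^w)_{i_1,\ldots,i_j}=((G^v:H^w)_{i_1,\ldots,i_{j-1}}^v:H^w)_{i_j}$ (empty sequence giving $G^v$); $(G^v:H^w)_k^{(m)}$ uses $k$ repeated $m$ times. $P_t^w$ is the path on $t$ vertices rooted at a leaf. $T_{1,3}^v=(P_1^v:P_2^w)_3$: a root $v$ with one child carrying three pendant 2-vertex paths. $S_{2,t}=(P_1^v:P_1^w)_1^{(t)}$, rooted at its center: the spider with $t$ legs of length $2$. -}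

module Defs where

open import Data.Nat using (ℕ; zero; suc; _+_; _<_)
open import Data.Bool using (Bool; true; false; _∧_; not)
open import Data.Fin using (Fin; zero; _↑ˡ_; _↑ʳ_)
open import Data.Fin.Subset using (Subset; ∣_∣)
open import Data.Vec using (Vec; []; _∷_; lookup)
open import Data.List using (List; []; _∷_; map; _++_; filterᵇ; length; foldl; replicate)
open import Data.Product using (_×_; _,_)
open import Relation.Binary.PropositionalEquality using (_≡_)
open import Data.Nat using (_≡ᵇ_)

-- A finite simple graph on vertex set Fin n, given by a list of edges
-- (an edge (u , v) makes u and v adjacent; orientation is irrelevant).
record Graph : Set where
  constructor mkGraph
  field
    size  : ℕ
    edges : List (Fin size × Fin size)
open Graph public

record RGraph : Set where
  constructor mkRGraph
  field
    graph : Graph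
    root  : Fin (size graph)
open RGraph public

allSubsets : (n : ℕ) → List (Subset n)
allSubsets zero    = [] ∷ []
allSubsets (suc n) = map (true ∷_) (allSubsets n) ++ map (false ∷_) (allSubsets n)

allᵇ : {A : Set} → (A → Bool) → List A → Bool
allᵇ p []       = true
allᵇ p (x ∷ xs) = p x ∧ allᵇ p xs

isIndependent : (G : Graph) → Subset (size G) → Bool
isIndependent G S = allᵇ (λ { (u , v) → not (lookup S u ∧ lookup S v) }) (edges G)

-- s_i(G): the number of independent sets of size i in G,
-- i.e. the i-th coefficient of the independence polynomial I(G;x).
indCoeff : Graph → ℕ → ℕ
indCoeff G i =
  length (filterᵇ (λ S → isIndependent G S ∧ (∣ S ∣ ≡ᵇ i)) (allSubsets (size G)))

MonicOfDegree : Graph → ℕ → Set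
MonicOfDegree G d = (indCoeff G d ≡ 1) × (∀ j → d < j → indCoeff G j ≡ 0)

-- Disjoint union of G and H plus the edge (root G)(root H), rooted at root G.
join : RGraph → RGraph → RGraph
join (mkRGraph (mkGraph n eG) r) (mkRGraph (mkGraph m eH) w) =
  mkRGraph
    (mkGraph (n + m)
      (((r ↑ˡ m) , (n ↑ʳ w))
        ∷ map (λ { (a , b) → (a ↑ˡ m) , (b ↑ˡ m) }) eG
       ++ map (λ { (a , b) → (n ↑ʳ a) , (n ↑ʳ b) }) eH))
    (r ↑ˡ m)

P₁ : RGraph
P₁ = mkRGraph (mkGraph 1 []) zero

-- pathR t = P_{t+1}^w : path on t+1 vertices rooted at a leaf.
pathR : ℕ → RGraph
pathR zero    = P₁
pathR (suc t) = join P₁ (pathR t)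

P₂ : RGraph
P₂ = pathR 1

-- Z_k(H^w): new vertex v₀ (the root) joined to the roots of k disjoint copies of H.
Z : ℕ → RGraph → RGraph
Z zero    H = P₁
Z (suc k) H = join (Z k H) H

attach : RGraph → RGraph → ℕ → RGraph
attach G H k = join G (Z k H)

attachSeq : RGraph → RGraph → List ℕ → RGraph
attachSeq G H is = foldl (λ G' i → attach G' H i) G is

attachRep : RGraph → RGraph → ℕ → ℕ → RGraph
attachRep G H k m = attachSeq G H (replicate m k)

T₁₃ : RGraph
T₁₃ = attach P₁ P₂ 3

S₂ : ℕ → RGraph
S₂ t = attachRep P₁ P₁ 1 t

{-# OPTIONS --safe #-}
module Submission where

-- I(G) is monic of degree d exactly when G has a unique independent set of size d and
-- none larger.  Such maxima are tracked separately among the independent sets avoiding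
-- and containing the root: in the join of G and H (an edge between the two roots) a set
-- avoiding the root of G combines with any set of H, a set containing it only with one
-- avoiding the root of H, and sizes add.  So in Z_k(P₂) the root together with the k
-- leaves is the unique maximum (size k + 1), while root-avoiding sets have size ≤ k; and
-- S_{2,k} is Z_k(P₂).  In the tree the maximum avoids the top root and is unique, of size
-- 4 + (k + 1) + (k + m + 1), whereas sets containing the top root have size ≤ 4 + k + (k + m).

open import Defs
open import Data.Bool using (Bool; true; false; _∧_; not; T)
open import Data.Bool.Properties using (∧-assoc; T-∧; T-not-≡)
open import Data.Fin.Subset using (Subset; Side; inside; outside; ∣_∣)
open import Data.List as List using (List; []; _∷_; map; filterᵇ; length; foldl; replicate)
open import Data.List.Properties using (filter-none; filter-accept; filter-++; length-++)
open import Data.List.Relation.Unary.All using (universal)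
open import Data.Nat using (ℕ; zero; suc; _+_; _*_; _≤_; _<_; z≤n; s≤s)
open import Data.Nat.Properties
open import Data.Nat.Tactic.RingSolver using (solve-∀)
open import Data.Product using (_×_; _,_; proj₁)
open import Data.Sum using (inj₁; inj₂; [_,_]; swap)
open import Data.Vec using ([]; _∷_; _++_; lookup; splitAt)
open import Data.Vec.Properties using (lookup-++ˡ; lookup-++ʳ; ∷-injectiveˡ; ∷-injectiveʳ)
open import Function using (_∘_; _⇔_; mk⇔; Equivalence)
open import Relation.Binary.PropositionalEquality hiding ([_])
open import Relation.Nullary using (¬_; contradiction)
open import Relation.Nullary.Decidable using (T?)
open import Relation.Unary using (_⊆_; _∪_)

open Equivalence using (to; from)

length-filterᵇ-none : ∀ {A : Set} (p : A → Bool) → (∀ x → ¬ T (p x)) →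
                      ∀ xs → length (filterᵇ p xs) ≡ 0
length-filterᵇ-none p none xs = cong length (filter-none (T? ∘ p) (universal none xs))

length-filterᵇ-map : ∀ {A B : Set} (p : B → Bool) (f : A → B) xs →
                     length (filterᵇ p (map f xs)) ≡ length (filterᵇ (p ∘ f) xs)
length-filterᵇ-map p f []       = refl
length-filterᵇ-map p f (x ∷ xs) with p (f x)
... | true  = cong suc (length-filterᵇ-map p f xs)
... | false = length-filterᵇ-map p f xs

length-filterᵇ-allSubsets-suc : ∀ {n} (p : Subset (suc n) → Bool) →
  length (filterᵇ p (allSubsets (suc n))) ≡
  length (filterᵇ (p ∘ (inside ∷_)) (allSubsets n)) + length (filterᵇ (p ∘ (outside ∷_)) (allSubsets n))
length-filterᵇ-allSubsets-suc {n} p = begin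
  length (filterᵇ p (ins List.++ outs))          ≡⟨ cong length (filter-++ (T? ∘ p) ins outs) ⟩
  length (filterᵇ p ins List.++ filterᵇ p outs)  ≡⟨ length-++ (filterᵇ p ins) ⟩
  length (filterᵇ p ins) + length (filterᵇ p outs)
    ≡⟨ cong₂ _+_ (length-filterᵇ-map p _ (allSubsets n)) (length-filterᵇ-map p _ (allSubsets n)) ⟩
  length (filterᵇ (p ∘ (inside ∷_)) (allSubsets n)) + length (filterᵇ (p ∘ (outside ∷_)) (allSubsets n))
    ∎
  where
  open ≡-Reasoning
  ins outs : List (Subset (suc n))
  ins  = map (inside ∷_) (allSubsets n)
  outs = map (outside ∷_) (allSubsets n)

length-filterᵇ-allSubsets-singleton : ∀ {n} (p : Subset n → Bool) (S₀ : Subset n) → T (p S₀) →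
  (∀ S → T (p S) → S ≡ S₀) → length (filterᵇ p (allSubsets n)) ≡ 1
length-filterᵇ-allSubsets-singleton {0} p [] pS₀ _ = cong length (filter-accept (T? ∘ p) pS₀)
length-filterᵇ-allSubsets-singleton {suc n} p (inside ∷ S₀) pS₀ unique =
  trans (length-filterᵇ-allSubsets-suc p)
    (cong₂ _+_ (length-filterᵇ-allSubsets-singleton _ S₀ pS₀ (λ _ → ∷-injectiveʳ ∘ unique _))
               (length-filterᵇ-none _ (λ _ → (λ ()) ∘ ∷-injectiveˡ ∘ unique _) (allSubsets n)))
length-filterᵇ-allSubsets-singleton {suc n} p (outside ∷ S₀) pS₀ unique =
  trans (length-filterᵇ-allSubsets-suc p)
    (cong₂ _+_ (length-filterᵇ-none _ (λ _ → (λ ()) ∘ ∷-injectiveˡ ∘ unique _) (allSubsets n))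
               (length-filterᵇ-allSubsets-singleton _ S₀ pS₀ (λ _ → ∷-injectiveʳ ∘ unique _)))

∣p++q∣≡∣p∣+∣q∣ : ∀ {n m} (p : Subset n) (q : Subset m) → ∣ p ++ q ∣ ≡ ∣ p ∣ + ∣ q ∣
∣p++q∣≡∣p∣+∣q∣ []            q = refl
∣p++q∣≡∣p∣+∣q∣ (inside  ∷ p) q = cong suc (∣p++q∣≡∣p∣+∣q∣ p q)
∣p++q∣≡∣p∣+∣q∣ (outside ∷ p) q = ∣p++q∣≡∣p∣+∣q∣ p q

+-≡-summands : ∀ {x y a b} → x ≤ a → y ≤ b → x + y ≡ a + b → x ≡ a × y ≡ b
+-≡-summands {x} {y} {a} {b} x≤a y≤b x+y≡a+b = x≡a , +-cancelˡ-≡ a y b (subst (λ z → z + y ≡ a + b) x≡a x+y≡a+b)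
  where
  x≡a : x ≡ a
  x≡a = ≤-antisym x≤a (+-cancelʳ-≤ b a x (subst (_≤ x + b) x+y≡a+b (+-monoʳ-≤ x y≤b)))

BoundedBy : ∀ {n} → (Subset n → Set) → ℕ → Set
BoundedBy P a = ∀ S → P S → ∣ S ∣ ≤ a

record UniqueMaximum {n} (P : Subset n → Set) (a : ℕ) : Set where
  field
    bounded   : BoundedBy P a
    maximum   : Subset n
    maximum∈P : P maximum
    ∣maximum∣ : ∣ maximum ∣ ≡ a
    unique    : ∀ S → P S → ∣ S ∣ ≡ a → S ≡ maximum
open UniqueMaximum

IsProduct : ∀ {n m} → (Subset (n + m) → Set) → (Subset n → Set) → (Subset m → Set) → Set
IsProduct R P Q = ∀ S₁ S₂ → R (S₁ ++ S₂) ⇔ (P S₁ × Q S₂)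

module _ {n m} {R : Subset (n + m) → Set} {P : Subset n → Set} {Q : Subset m → Set}
         (R≈P×Q : IsProduct R P Q) where

  bounded-product : ∀ {a b} → BoundedBy P a → BoundedBy Q b → BoundedBy R (a + b)
  bounded-product P≤a Q≤b S RS with splitAt n S
  ... | S₁ , S₂ , refl with PS₁ , QS₂ ← to (R≈P×Q S₁ S₂) RS =
    subst (_≤ _) (sym (∣p++q∣≡∣p∣+∣q∣ S₁ S₂)) (+-mono-≤ (P≤a S₁ PS₁) (Q≤b S₂ QS₂))

  uniqueMaximum-product : ∀ {a b} → UniqueMaximum P a → UniqueMaximum Q b → UniqueMaximum R (a + b)
  uniqueMaximum-product maxP maxQ = record
    { bounded   = bounded-product (bounded maxP) (bounded maxQ)
    ; maximum   = maximum maxP ++ maximum maxQ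
    ; maximum∈P = from (R≈P×Q _ _) (maximum∈P maxP , maximum∈P maxQ)
    ; ∣maximum∣ = trans (∣p++q∣≡∣p∣+∣q∣ (maximum maxP) _) (cong₂ _+_ (∣maximum∣ maxP) (∣maximum∣ maxQ))
    ; unique    = uniqueness
    }
    where
    uniqueness : ∀ S → R S → ∣ S ∣ ≡ _ → S ≡ maximum maxP ++ maximum maxQ
    uniqueness S RS ∣S∣≡a+b with splitAt n S
    ... | S₁ , S₂ , refl with PS₁ , QS₂ ← to (R≈P×Q S₁ S₂) RS
                         with ∣S₁∣≡a , ∣S₂∣≡b ← +-≡-summands (bounded maxP S₁ PS₁) (bounded maxQ S₂ QS₂)
                                                  (trans (sym (∣p++q∣≡∣p∣+∣q∣ S₁ S₂)) ∣S∣≡a+b) =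
      cong₂ _++_ (unique maxP S₁ PS₁ ∣S₁∣≡a) (unique maxQ S₂ QS₂ ∣S₂∣≡b)

module _ {n} {R P Q : Subset n → Set} (R⊆P∪Q : R ⊆ P ∪ Q) where

  bounded-∪ : ∀ {a} → BoundedBy P a → BoundedBy Q a → BoundedBy R a
  bounded-∪ P≤a Q≤a S RS = [ P≤a S , Q≤a S ] (R⊆P∪Q RS)

  uniqueMaximum-∪ : ∀ {a b} → P ⊆ R → UniqueMaximum P a → BoundedBy Q b → b < a → UniqueMaximum R a
  uniqueMaximum-∪ P⊆R maxP Q≤b b<a = record
    { bounded   = bounded-∪ (bounded maxP) (λ S QS → <⇒≤ (≤-<-trans (Q≤b S QS) b<a))
    ; maximum   = maximum maxP
    ; maximum∈P = P⊆R (maximum∈P maxP)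
    ; ∣maximum∣ = ∣maximum∣ maxP
    ; unique    = λ S RS ∣S∣≡a → [ (λ PS → unique maxP S PS ∣S∣≡a)
                                 , (λ QS → contradiction (≤-<-trans (Q≤b S QS) b<a) (<-irrefl ∣S∣≡a))
                                 ] (R⊆P∪Q RS)
    }

Independent : (G : Graph) → Subset (size G) → Set
Independent G S = T (isIndependent G S)

monicOfDegree : ∀ G {d} → UniqueMaximum (Independent G) d → MonicOfDegree G d
monicOfDegree G {d} maxG = coefficient-d , coefficients-above-d
  where
  coefficient-d : indCoeff G d ≡ 1
  coefficient-d = length-filterᵇ-allSubsets-singleton _ (maximum maxG)
    (from T-∧ (maximum∈P maxG , ≡⇒≡ᵇ _ d (∣maximum∣ maxG)))
    (λ S indep-of-size-d → let (indep , of-size-d) = to T-∧ indep-of-size-d in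
                           unique maxG S indep (≡ᵇ⇒≡ _ d of-size-d))

  coefficients-above-d : ∀ j → d < j → indCoeff G j ≡ 0
  coefficients-above-d j d<j = length-filterᵇ-none _
    (λ S indep-of-size-j → let (indep , of-size-j) = to T-∧ indep-of-size-j in
                           <-irrefl (≡ᵇ⇒≡ _ j of-size-j) (≤-<-trans (bounded maxG S indep) d<j))
    (allSubsets (size G))

allᵇ-++ : ∀ {A : Set} (p : A → Bool) xs ys → allᵇ p (xs List.++ ys) ≡ allᵇ p xs ∧ allᵇ p ys
allᵇ-++ p []       ys = refl
allᵇ-++ p (x ∷ xs) ys = trans (cong (p x ∧_) (allᵇ-++ p xs ys)) (sym (∧-assoc (p x) _ _))

allᵇ-map : ∀ {A B : Set} {p : B → Bool} {f : A → B} {q : A → Bool} →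
           (∀ x → p (f x) ≡ q x) → ∀ xs → allᵇ p (map f xs) ≡ allᵇ q xs
allᵇ-map p∘f≗q []       = refl
allᵇ-map p∘f≗q (x ∷ xs) = cong₂ _∧_ (p∘f≗q x) (allᵇ-map p∘f≗q xs)

module _ (G H : RGraph) (S₁ : Subset (size (graph G))) (S₂ : Subset (size (graph H))) where

  lookup-root-join : lookup (S₁ ++ S₂) (root (join G H)) ≡ lookup S₁ (root G)
  lookup-root-join = lookup-++ˡ S₁ S₂ (root G)

  isIndependent-join : isIndependent (graph (join G H)) (S₁ ++ S₂) ≡
    not (lookup S₁ (root G) ∧ lookup S₂ (root H)) ∧ (isIndependent (graph G) S₁ ∧ isIndependent (graph H) S₂)
  isIndependent-join = cong₂ _∧_ (cong-nand (lookup-++ˡ S₁ S₂ (root G)) (lookup-++ʳ S₁ S₂ (root H)))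
    (trans (allᵇ-++ _ (map _ (edges (graph G))) (map _ (edges (graph H))))
      (cong₂ _∧_ (allᵇ-map (λ (u , v) → cong-nand (lookup-++ˡ S₁ S₂ u) (lookup-++ˡ S₁ S₂ v)) (edges (graph G)))
                 (allᵇ-map (λ (u , v) → cong-nand (lookup-++ʳ S₁ S₂ u) (lookup-++ʳ S₁ S₂ v)) (edges (graph H)))))
    where
    cong-nand : ∀ {x x′ y y′} → x ≡ x′ → y ≡ y′ → not (x ∧ y) ≡ not (x′ ∧ y′)
    cong-nand = cong₂ (λ x y → not (x ∧ y))

  Independent-join : Independent (graph (join G H)) (S₁ ++ S₂) ⇔
    (T (not (lookup S₁ (root G) ∧ lookup S₂ (root H))) × Independent (graph G) S₁ × Independent (graph H) S₂)
  Independent-join rewrite isIndependent-join =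
    mk⇔ (λ t → let (nand , ij) = to T-∧ t in nand , to T-∧ ij)
        (λ (nand , i , j) → from T-∧ (nand , from T-∧ (i , j)))

IndependentWithRoot : (G : RGraph) → Side → Subset (size (graph G)) → Set
IndependentWithRoot G b S = Independent (graph G) S × lookup S (root G) ≡ b

Independent-byRoot : ∀ G → Independent (graph G) ⊆ IndependentWithRoot G inside ∪ IndependentWithRoot G outside
Independent-byRoot G {S} indep = by-side (lookup S (root G)) refl
  where
  by-side : ∀ b → lookup S (root G) ≡ b → (IndependentWithRoot G inside ∪ IndependentWithRoot G outside) S
  by-side inside  root-in  = inj₁ (indep , root-in)
  by-side outside root-out = inj₂ (indep , root-out)

module _ (G H : RGraph) where

  join-outside : IsProduct (IndependentWithRoot (join G H) outside)
                           (IndependentWithRoot G outside) (Independent (graph H))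
  join-outside S₁ S₂ = mk⇔
    (λ (indep , root-out) → let (_ , indep₁ , indep₂) = to (Independent-join G H S₁ S₂) indep in
                            (indep₁ , trans (sym (lookup-root-join G H S₁ S₂)) root-out) , indep₂)
    (λ ((indep₁ , root-out) , indep₂) →
       from (Independent-join G H S₁ S₂) (subst (λ x → T (not (x ∧ _))) (sym root-out) _ , indep₁ , indep₂) ,
       trans (lookup-root-join G H S₁ S₂) root-out)

  join-inside : IsProduct (IndependentWithRoot (join G H) inside)
                          (IndependentWithRoot G inside) (IndependentWithRoot H outside)
  join-inside S₁ S₂ = mk⇔
    (λ (indep , root-in) → let (nand , indep₁ , indep₂) = to (Independent-join G H S₁ S₂) indep
                               root₁-in = trans (sym (lookup-root-join G H S₁ S₂)) root-in in
                           (indep₁ , root₁-in) , indep₂ , to T-not-≡ (subst (λ x → T (not (x ∧ _))) root₁-in nand))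
    (λ ((indep₁ , root₁-in) , indep₂ , root₂-out) →
       from (Independent-join G H S₁ S₂)
            (subst (λ x → T (not (x ∧ _))) (sym root₁-in) (from T-not-≡ root₂-out) , indep₁ , indep₂) ,
       trans (lookup-root-join G H S₁ S₂) root₁-in)

module _ (G : RGraph) where

  bounded-byRoot : ∀ {a} → BoundedBy (IndependentWithRoot G inside) a → BoundedBy (IndependentWithRoot G outside) a →
                   BoundedBy (Independent (graph G)) a
  bounded-byRoot = bounded-∪ (λ {S} → Independent-byRoot G {S})

  uniqueMaximum-rootInside : ∀ {a b} → UniqueMaximum (IndependentWithRoot G inside) a →
    BoundedBy (IndependentWithRoot G outside) b → b < a → UniqueMaximum (Independent (graph G)) a
  uniqueMaximum-rootInside = uniqueMaximum-∪ (λ {S} → Independent-byRoot G {S}) proj₁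

  uniqueMaximum-rootOutside : ∀ {a b} → UniqueMaximum (IndependentWithRoot G outside) a →
    BoundedBy (IndependentWithRoot G inside) b → b < a → UniqueMaximum (Independent (graph G)) a
  uniqueMaximum-rootOutside = uniqueMaximum-∪ (λ {S} → swap ∘ Independent-byRoot G {S}) proj₁

P₁-withRoot : ∀ b → UniqueMaximum (IndependentWithRoot P₁ b) ∣ b ∷ [] ∣
P₁-withRoot b = record
  { bounded   = λ S w → ≤-reflexive (cong ∣_∣ (forced S w))
  ; maximum   = b ∷ []
  ; maximum∈P = _ , refl
  ; ∣maximum∣ = refl
  ; unique    = λ S w _ → forced S w
  }
  where
  forced : ∀ S → IndependentWithRoot P₁ b S → S ≡ b ∷ []
  forced (_ ∷ []) (_ , refl) = refl

P₁-unique : UniqueMaximum (Independent (graph P₁)) 1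
P₁-unique = uniqueMaximum-rootInside P₁ (P₁-withRoot inside) (bounded (P₁-withRoot outside)) (s≤s z≤n)

P₂-outside : UniqueMaximum (IndependentWithRoot P₂ outside) 1
P₂-outside = uniqueMaximum-product (join-outside P₁ P₁) (P₁-withRoot outside) P₁-unique

P₂-bounded : BoundedBy (Independent (graph P₂)) 1
P₂-bounded = bounded-byRoot P₂
  (bounded-product (join-inside P₁ P₁) (bounded (P₁-withRoot inside)) (bounded (P₁-withRoot outside)))
  (bounded P₂-outside)

module _ {H : RGraph} {b : ℕ} where

  Z-outside-bounded : BoundedBy (Independent (graph H)) b → ∀ k → BoundedBy (IndependentWithRoot (Z k H) outside) (k * b)
  Z-outside-bounded H≤b zero    = bounded (P₁-withRoot outside)
  Z-outside-bounded H≤b (suc k) = subst (BoundedBy _) (+-comm (k * b) b)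
    (bounded-product (join-outside (Z k H) H) (Z-outside-bounded H≤b k) H≤b)

  Z-inside-unique : UniqueMaximum (IndependentWithRoot H outside) b → ∀ k →
                    UniqueMaximum (IndependentWithRoot (Z k H) inside) (1 + k * b)
  Z-inside-unique maxH zero    = P₁-withRoot inside
  Z-inside-unique maxH (suc k) = subst (UniqueMaximum _) (cong suc (+-comm (k * b) b))
    (uniqueMaximum-product (join-inside (Z k H) H) (Z-inside-unique maxH k) maxH)

  Z-unique : UniqueMaximum (IndependentWithRoot H outside) b → BoundedBy (Independent (graph H)) b → ∀ k →
             UniqueMaximum (Independent (graph (Z k H))) (1 + k * b)
  Z-unique maxH H≤b k = uniqueMaximum-rootInside (Z k H) (Z-inside-unique maxH k) (Z-outside-bounded H≤b k) (n<1+n (k * b))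

Z-P₂-unique : ∀ k → UniqueMaximum (Independent (graph (Z k P₂))) (suc k)
Z-P₂-unique k = subst (UniqueMaximum _) (cong suc (*-identityʳ k)) (Z-unique P₂-outside P₂-bounded k)

Z-P₂-outside-bounded : ∀ k → BoundedBy (IndependentWithRoot (Z k P₂) outside) k
Z-P₂-outside-bounded k = subst (BoundedBy _) (*-identityʳ k) (Z-outside-bounded P₂-bounded k)

T₁₃-outside : UniqueMaximum (IndependentWithRoot T₁₃ outside) 4
T₁₃-outside = uniqueMaximum-product (join-outside P₁ (Z 3 P₂)) (P₁-withRoot outside) (Z-P₂-unique 3)

T₁₃-inside : BoundedBy (IndependentWithRoot T₁₃ inside) 4
T₁₃-inside = bounded-product (join-inside P₁ (Z 3 P₂)) (bounded (P₁-withRoot inside)) (Z-P₂-outside-bounded 3)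

module _ (G : RGraph) {a : ℕ} (k : ℕ) where

  attach-P₂-outside : UniqueMaximum (IndependentWithRoot G outside) a →
                      UniqueMaximum (IndependentWithRoot (attach G P₂ k) outside) (a + suc k)
  attach-P₂-outside maxG = uniqueMaximum-product (join-outside G (Z k P₂)) maxG (Z-P₂-unique k)

  attach-P₂-inside : BoundedBy (IndependentWithRoot G inside) a →
                     BoundedBy (IndependentWithRoot (attach G P₂ k) inside) (a + k)
  attach-P₂-inside G≤a = bounded-product (join-inside G (Z k P₂)) G≤a (Z-P₂-outside-bounded k)

foldl-replicate-suc : ∀ {A B : Set} (f : A → B → A) x y n →
                      foldl f x (replicate (suc n) y) ≡ f (foldl f x (replicate n y)) y
foldl-replicate-suc f x y zero    = refl
foldl-replicate-suc f x y (suc n) = foldl-replicate-suc f (f x y) y n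

S₂≡Z-P₂ : ∀ t → S₂ t ≡ Z t P₂
S₂≡Z-P₂ zero    = refl
S₂≡Z-P₂ (suc t) = trans (foldl-replicate-suc (λ G i → attach G P₁ i) P₁ 1 t) (cong (λ G → join G P₂) (S₂≡Z-P₂ t))

lemma4p7 : (k m : ℕ) →
    MonicOfDegree (graph (attachSeq T₁₃ P₂ (k ∷ (k + m) ∷ []))) (2 * k + m + 6)
    × MonicOfDegree (graph (S₂ k)) (k + 1)
lemma4p7 k m = monicOfDegree (graph tree) tree-unique , monicOfDegree (graph (S₂ k)) spider-unique
  where
  T₁₃-k : RGraph
  T₁₃-k = attach T₁₃ P₂ k

  tree : RGraph
  tree = attach T₁₃-k P₂ (k + m)

  tree-unique : UniqueMaximum (Independent (graph tree)) (2 * k + m + 6)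
  tree-unique = subst (UniqueMaximum _) (degree k m) (uniqueMaximum-rootOutside tree
    (attach-P₂-outside T₁₃-k (k + m) (attach-P₂-outside T₁₃ k T₁₃-outside))
    (attach-P₂-inside T₁₃-k (k + m) (attach-P₂-inside T₁₃ k T₁₃-inside))
    (+-mono-< (+-monoʳ-< 4 (n<1+n k)) (n<1+n (k + m))))
    where
    degree : ∀ i j → 4 + suc i + suc (i + j) ≡ 2 * i + j + 6
    degree = solve-∀

  spider-unique : UniqueMaximum (Independent (graph (S₂ k))) (k + 1)
  spider-unique = subst₂ (λ G d → UniqueMaximum (Independent (graph G)) d) (sym (S₂≡Z-P₂ k)) (+-comm 1 k) (Z-P₂-unique k)
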